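{- Assume the set of critical numbers is nonempty and $l_1>l_1'$. If $n,m$ are not both odd then $\lambda\in X_0^+(m)$. If $n\equiv m\equiv 1\bmod 2$ and $m>1$, then $\lambda_{mod}:=(\lambda_1,\dots,\lambda_{\frac{m+1}{2}},\lambda_{\frac{m+3}{2}}-1,\dots,\lambda_m-1)\in X_0^+(m)$ and the truncated $\lambda_{tr}:=(\lambda_1,\dots,\lambda_{\frac{m-1}{2}},\lambda_{\frac{m+3}{2}},\dots,\lambda_m)\in X_0^+(m-1)$. For $m=1$ always $\lambda\in X_0^+(1)$.
   Context: For $N\ge1$, $X^+(N)=\{x\in\mathbb{Z}^N:x_1\ge\dots\ge x_N\}$ and $X_0^+(N)$ is the set of $x\in X^+(N)$ for which $x_i+x_{N+1-i}$ is independent of $i$. Let $L_0^+(N)$ be the set of $(w,l)\in\mathbb{Z}\times\mathbb{Z}^N$ with $l_1>\dots>l_N$, $l_i+l_{N+1-i}=0$ and $w+l_i\equiv N+1\bmod2$. Fix $n,m\ge1$, $(w,l)\in L_0^+(n)$, $(w',l')\in L_0^+(m)$, $\delta,\delta'\in\{0,1\}$. In Knapp's notation for $W_{\mathbb{R}}$, $(l,t)$ ($l\ge1$) is irreducible $2$-dimensional and $(\mathrm{sgn}^\epsilon,t)$ is $1$-dimensional, $L(s,(l,t))=\Gamma_{\mathbb{C}}(s+t+\frac l2)$, $L(s,(\mathrm{sgn}^\epsilon,t))=\Gamma_{\mathbb{R}}(s+t+\epsilon)$, $\Gamma_{\mathbb{R}}(s)=\pi^{ -s/2}\Gamma(s/2)$,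 $\Gamma_{\mathbb{C}}(s)=2(2\pi)^{ -s}\Gamma(s)$; multiplicative over constituents. $\pi_\infty^W=\bigoplus_{i\le n/2}(l_i,-w/2)$ plus $(\mathrm{sgn}^\delta,-w/2)$ if $n$ odd; $\sigma_\infty^W$ analogously; $\tau=\pi_\infty^W\otimes\sigma_\infty^W$. $t\in\frac{n+m}{2}+\mathbb{Z}$ is critical if neither $L(s,\tau)$ nor $L(1-s,\check\tau)$ has a pole at $s=t$. $\nu_j=\frac{w'+l'_j+2j-1-m}{2}$; position tuple: $a_j$ is the unique integer with $1\le a_j\le n-1$ and $l_{a_j}>l'_j\ge l_{1+a_j}$; $\lambda_j=\nu_j+a_j-j$. -}

module Defs where

open import Data.Nat as ℕ using (ℕ; zero; suc; _≡ᵇ_; _<ᵇ_)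
open import Data.Nat.DivMod using (_/_; _%_)
open import Data.Integer as ℤ using (ℤ; +_; -_; _+_; _-_; _*_; _/ℕ_; ∣_∣)
open import Data.Integer.Divisibility using (_∣_)
open import Data.Fin as Fin using (Fin; toℕ; inject₁; opposite)
open import Data.Bool using (Bool; true; false; if_then_else_; _xor_)
open import Data.List as List using (List; []; _∷_; [_]; _++_; concatMap; map; filter; allFin)
open import Data.List.Relation.Unary.Any using (Any)
open import Data.Product using (_×_; ∃; Σ)
open import Relation.Binary.PropositionalEquality using (_≡_)
open import Relation.Nullary using (¬_)
open import Data.Nat.Properties using (_<?_)

-- Integer vectors, indexed 0-based by Fin N (paper index i = toℕ i + 1)

X⁺ : (N : ℕ) → (Fin N → ℤ) → Set
X⁺ N x = ∀ (i j : Fin N) → toℕ i ℕ.≤ toℕ j → x j ℤ.≤ x i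

-- X₀⁺(N) : x ∈ X⁺(N) with x_i + x_{N+1-i} independent of i
-- (opposite i is the index N+1-i in paper's 1-based convention)
X₀⁺ : (N : ℕ) → (Fin N → ℤ) → Set
X₀⁺ N x = X⁺ N x × ∃ λ (c : ℤ) → ∀ (i : Fin N) → x i + x (opposite i) ≡ c

L₀⁺ : (N : ℕ) → ℤ → (Fin N → ℤ) → Set
L₀⁺ N w l =
  (∀ (i j : Fin N) → toℕ i ℕ.< toℕ j → l j ℤ.< l i)
  × (∀ (i : Fin N) → l i + l (opposite i) ≡ + 0)
  × (∀ (i : Fin N) → + 2 ∣ (w + l i - + suc N))

-- Irreducible representations of W_ℝ in Knapp's notation.
-- To stay inside ℤ, the twist t ∈ ½ℤ is stored DOUBLED: D = 2t.
--   two l D  : the 2-dimensional (l, D/2), l ≥ 1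
--   one ε D  : the 1-dimensional (sgn^ε, D/2), ε ∈ {0,1} as Bool

data IrrW : Set where
  two : ℕ → ℤ → IrrW
  one : Bool → ℤ → IrrW

RepW : Set
RepW = List IrrW

dualIrr : IrrW → IrrW
dualIrr (two l D) = two l (- D)
dualIrr (one ε D) = one ε (- D)

dual : RepW → RepW
dual = map dualIrr

absDiff : ℕ → ℕ → ℕ
absDiff a b = ∣ + a - + b ∣

tensorIrr : IrrW → IrrW → RepW
tensorIrr (two l D) (two l' D') =
  if l ≡ᵇ l'
    then two (l ℕ.+ l') (D + D') ∷ one false (D + D') ∷ one true (D + D') ∷ []
    else two (l ℕ.+ l') (D + D') ∷ two (absDiff l l') (D + D') ∷ []
tensorIrr (two l D) (one ε D') = [ two l (D + D') ]
tensorIrr (one ε D) (two l D') = [ two l (D + D') ]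
tensorIrr (one ε D) (one ε' D') = [ one (ε xor ε') (D + D') ]

tensor : RepW → RepW → RepW
tensor ρ σ = concatMap (λ r → concatMap (tensorIrr r) σ) ρ

-- Poles of L-functions, with s also doubled: S = 2s.
-- Γ(z) has poles exactly at z ∈ {0,-1,-2,...} and no zeros, so
--   L(s,(l,t)) = Γ_ℂ(s+t+l/2) has a pole at s  iff  s+t+l/2 = -k, k ∈ ℕ
--                                               iff  S + D + l = -2k
--   L(s,(sgn^ε,t)) = Γ_ℝ(s+t+ε) has a pole at s iff s+t+ε = -2k, k ∈ ℕ
--                                               iff  S + D + 2ε = -4k
-- and L(s,ρ) (a product of such factors) has a pole iff some factor does.

bit : Bool → ℕ
bit true = 1
bit false = 0

IrrPole : ℤ → IrrW → Set
IrrPole S (two l D) = ∃ λ (k : ℕ) → S + D + + l ≡ - (+ (2 ℕ.* k))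
IrrPole S (one ε D) = ∃ λ (k : ℕ) → S + D + + (2 ℕ.* bit ε) ≡ - (+ (4 ℕ.* k))

LPole : ℤ → RepW → Set
LPole S ρ = Any (IrrPole S) ρ

-- π_∞^W = ⊕_{i ≤ n/2} (l_i, -w/2)  [⊕ (sgn^δ,-w/2) if n odd]

archRep : (N : ℕ) → ℤ → (Fin N → ℤ) → Bool → RepW
archRep N w l δ =
  map (λ i → two ∣ l i ∣ (- w)) (filter (λ i → toℕ i <? (N / 2)) (allFin N))
  ++ (if N % 2 ≡ᵇ 1 then [ one δ (- w) ] else [])

-- t (stored as T = 2t) is critical for τ:
--   t ∈ (n+m)/2 + ℤ, L(s,τ) has no pole at s=t, L(1-s,τ̌) has no pole at s=t
Critical : (n m : ℕ) → RepW → ℤ → Set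
Critical n m τ T =
  + 2 ∣ (T - + (n ℕ.+ m)) × ¬ LPole T τ × ¬ LPole (+ 2 - T) (dual τ)

CriticalNonempty : (n m : ℕ) → RepW → Set
CriticalNonempty n m τ = ∃ λ (T : ℤ) → Critical n m τ T

τRep : (n m : ℕ) (w : ℤ) (l : Fin n → ℤ) (δ : Bool)
       (w' : ℤ) (l' : Fin m → ℤ) (δ' : Bool) → RepW
τRep n m w l δ w' l' δ' = tensor (archRep n w l δ) (archRep m w' l' δ')

-- Position tuple: a_j (paper, 1-based, 1 ≤ a_j ≤ n-1) is stored as
-- k = a j : Fin n₀ (n = suc n₀) with a_j = toℕ k + 1, so
-- l_{a_j} = l (inject₁ k) and l_{1+a_j} = l (suc k).
IsPositionTuple : (n₀ m : ℕ) → (Fin (suc n₀) → ℤ) → (Fin m → ℤ) → (Fin m → Fin n₀) → Set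
IsPositionTuple n₀ m l l' a =
  ∀ (j : Fin m) → (l' j ℤ.< l (inject₁ (a j))) × (l (Fin.suc (a j)) ℤ.≤ l' j)

-- ν_j = (w' + l'_j + 2j - 1 - m)/2   (j 1-based = toℕ j + 1; exact division)
ν : (m : ℕ) → ℤ → (Fin m → ℤ) → Fin m → ℤ
ν m w' l' j = (w' + l' j + + (2 ℕ.* toℕ j ℕ.+ 1) - + m) /ℕ 2

lam : (n₀ m : ℕ) → ℤ → (Fin m → ℤ) → (Fin m → Fin n₀) → Fin m → ℤ
lam n₀ m w' l' a j = ν m w' l' j + + toℕ (a j) - + toℕ j

lamMod : (m : ℕ) → (Fin m → ℤ) → Fin m → ℤ
lamMod m λ' j = if toℕ j <ᵇ (m ℕ.+ 1) / 2 then λ' j else λ' j - + 1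

lamTr : (m₀ : ℕ) → (Fin (suc m₀) → ℤ) → Fin m₀ → ℤ
lamTr m₀ λ' k = if toℕ k <ᵇ m₀ / 2 then λ' (inject₁ k) else λ' (Fin.suc k)

-- Write 2λ_j = (w' + 1 - m) + l'_j + 2a_j.  All l_i have the parity of
-- w + n + 1, so consecutive l_i differ by at least 2; this makes l'_j + 2a_j weakly
-- decreasing, hence λ ∈ X⁺(m).  Reflecting the interlacing l_{a_j} > l'_j ≥ l_{a_j+1}
-- through l_{n+1-i} = -l_i gives a_{m+1-j} = n - a_j whenever l'_j > l_{a_j+1}, and then
-- λ_j + λ_{m+1-j} does not depend on j.  The remaining case l'_j = l_{a_j+1} is where
-- criticality enters: if l and l' shared a weight L > 0, then τ would contain both
-- (sgn⁰, t+t') and (sgn¹, t+t'), and since 2t ≡ n + m (mod 2) one of these would give a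
-- pole of L(s,τ) or L(1-s,τ̌) at every candidate critical point.  So l'_j = l_{a_j+1} = 0,
-- which forces n and m odd and j to be the middle index; there λ_j + λ_j is one less
-- than the other pair sums, which is exactly the defect that λ_mod and λ_tr remove.

module Submission where

open import Data.Bool using (Bool; true; false; T)
open import Data.Bool.Properties using (T-≡)
open import Data.Fin as Fin using (Fin; toℕ; inject₁; opposite)
open import Data.Fin.Properties using (toℕ-injective; toℕ-inject₁; toℕ<n; opposite-prop)
open import Data.Integer as ℤ using (ℤ; ∣_∣; +_; -[1+_]; -_; _+_; _-_; _*_; _/ℕ_; _%ℕ_; +≤+)
open import Data.Integer.DivMod using (a≡a%ℕn+[a/ℕn]*n)
open import Data.Integer.Divisibility using () renaming (_∣_ to _∣ᵤ_)
open import Data.Integer.Divisibility.Signed using (_∣_; divides; ∣ᵤ⇒∣; ∣⇒∣ᵤ; ∣m∣n⇒∣m+n; ∣m∣n⇒∣m-n)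
import Data.Integer.Properties as ℤ
open import Data.Integer.Tactic.RingSolver using (solve-∀)
open import Data.List using (concatMap)
open import Data.List.Membership.Propositional using (_∈_; lose)
open import Data.List.Membership.Propositional.Properties using (∈-map⁺; ∈-filter⁺; ∈-allFin; ∈-++⁺ˡ; ∈-concatMap⁺)
open import Data.List.Relation.Unary.Any using (here; there)
open import Data.Nat as ℕ using (ℕ; zero; suc; _/_; _%_)
open import Data.Nat.DivMod using (_divMod_; result; m≡m%n+[m/n]*n; [m+kn]%n≡m%n; m*n/n≡m; /-monoˡ-≤)
open import Data.Nat.Divisibility using (n∣m⇒m%n≡0)
import Data.Nat.Properties as ℕ
import Data.Nat.Tactic.RingSolver as ℕ-Solver
open import Data.Product using (∃; _×_; _,_; proj₁; proj₂)
open import Data.Sum using (_⊎_; inj₁; inj₂)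
open import Function using (_∘_; Equivalence)
open import Relation.Binary.Definitions using (tri<; tri≈; tri>)
open import Relation.Binary.PropositionalEquality
  using (_≡_; _≢_; refl; sym; trans; cong; cong₂; subst; subst₂; module ≡-Reasoning)
open import Relation.Nullary using (¬_; yes; no; contradiction)

open import Defs

-- Parity

d∣i⇒i%ℕd≡0 : ∀ i d .{{_ : ℕ.NonZero d}} → + d ∣ᵤ i → i %ℕ d ≡ 0
d∣i⇒i%ℕd≡0 (+ k) d d∣k = n∣m⇒m%n≡0 k d d∣k
d∣i⇒i%ℕd≡0 -[1+ k ] d d∣k with suc k % d | n∣m⇒m%n≡0 (suc k) d d∣k
... | .0 | refl = refl

i/ℕd*d≡i : ∀ i d .{{_ : ℕ.NonZero d}} → + d ∣ᵤ i → i /ℕ d * + d ≡ i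
i/ℕd*d≡i i d d∣i = sym (begin
  i                           ≡⟨ a≡a%ℕn+[a/ℕn]*n i d ⟩
  + (i %ℕ d) + i /ℕ d * + d   ≡⟨ cong (λ r → + r + i /ℕ d * + d) (d∣i⇒i%ℕd≡0 i d d∣i) ⟩
  + 0 + i /ℕ d * + d          ≡⟨ ℤ.+-identityˡ _ ⟩
  i /ℕ d * + d                ∎)
  where open ≡-Reasoning

-[1+n]≡-1-n : ∀ n → -[1+ n ] ≡ - + 1 - + n
-[1+n]≡-1-n zero    = refl
-[1+n]≡-1-n (suc n) = refl

even-gap : ∀ {x y} → + 2 ∣ x - y → y ℤ.< x + + 2 → y ℤ.≤ x
even-gap {x} {y} (divides (+ k) x-y≡2k) _ =
  ℤ.0≤i-j⇒j≤i (subst (+ 0 ℤ.≤_) (sym (trans x-y≡2k (sym (ℤ.pos-* k 2)))) (+≤+ ℕ.z≤n))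
even-gap {x} {y} (divides -[1+ k ] x-y≡-2[1+k]) y<x+2 =
  contradiction (subst (x + + 2 ℤ.≤_) (sym y≡x+2+2k) (ℤ.i≤i+j (x + + 2) (+ (k ℕ.* 2)))) (ℤ.<⇒≱ y<x+2)
  where
  y≡x+2+2k : y ≡ x + + 2 + + (k ℕ.* 2)
  y≡x+2+2k = begin
    y                        ≡⟨ y≡x-[x-y] x y ⟩
    x - (x - y)              ≡⟨ cong (λ d → x - d) x-y≡-2[1+k] ⟩
    x - -[1+ k ] * + 2       ≡⟨ cong (λ q → x - q * + 2) (-[1+n]≡-1-n k) ⟩
    x - (- + 1 - + k) * + 2  ≡⟨ x-[-1-k]*2 x (+ k) ⟩
    x + + 2 + + k * + 2      ≡⟨ cong (λ z → x + + 2 + z) (sym (ℤ.pos-* k 2)) ⟩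
    x + + 2 + + (k ℕ.* 2)    ∎
    where
    open ≡-Reasoning
    y≡x-[x-y] : ∀ x y → y ≡ x - (x - y)
    y≡x-[x-y] = solve-∀
    x-[-1-k]*2 : ∀ x k → x - (- + 1 - k) * + 2 ≡ x + + 2 + k * + 2
    x-[-1-k]*2 = solve-∀

even-<⇒+2≤ : ∀ {x y} → + 2 ∣ x - y → y ℤ.< x → y + + 2 ℤ.≤ x
even-<⇒+2≤ {x} {y} 2∣x-y y<x = even-gap 2∣x-[y+2] (ℤ.+-monoˡ-< (+ 2) y<x)
  where
  x-y-2≡x-[y+2] : ∀ x y → x - y - + 2 ≡ x - (y + + 2)
  x-y-2≡x-[y+2] = solve-∀
  2∣x-[y+2] : + 2 ∣ x - (y + + 2)
  2∣x-[y+2] = subst (+ 2 ∣_) (x-y-2≡x-[y+2] x y) (∣m∣n⇒∣m-n 2∣x-y (divides (+ 1) refl))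

even-diff : ∀ {n} w c (f : Fin n → ℤ) → (∀ i → + 2 ∣ w + f i - c) → ∀ i j → + 2 ∣ f i - f j
even-diff w c f 2∣w+f-c i j = subst (+ 2 ∣_) (cancel w c (f i) (f j)) (∣m∣n⇒∣m-n (2∣w+f-c i) (2∣w+f-c j))
  where
  cancel : ∀ w c a b → (w + a - c) - (w + b - c) ≡ a - b
  cancel = solve-∀

i+k≡j⇒i≡j-k : ∀ {i j} k → i + k ≡ j → i ≡ j - k
i+k≡j⇒i≡j-k {i} k i+k≡j = trans (i≡i+k-k i k) (cong (λ s → s - k) i+k≡j)
  where
  i≡i+k-k : ∀ i k → i ≡ i + k - k
  i≡i+k-k = solve-∀

1+[m+m]%2≡1 : ∀ m → suc (m ℕ.+ m) % 2 ≡ 1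
1+[m+m]%2≡1 m = trans (cong (_% 2) (1+[m+m]≡1+m*2 m)) ([m+kn]%n≡m%n 1 m 2)
  where
  1+[m+m]≡1+m*2 : ∀ m → suc (m ℕ.+ m) ≡ 1 ℕ.+ m ℕ.* 2
  1+[m+m]≡1+m*2 = ℕ-Solver.solve-∀

[m+m]%2≡0 : ∀ m → (m ℕ.+ m) % 2 ≡ 0
[m+m]%2≡0 m = trans (cong (_% 2) (m+m≡m*2 m)) ([m+kn]%n≡m%n 0 m 2)
  where
  m+m≡m*2 : ∀ m → m ℕ.+ m ≡ 0 ℕ.+ m ℕ.* 2
  m+m≡m*2 = ℕ-Solver.solve-∀

1+[m+m]≢n+n : ∀ m n → suc (m ℕ.+ m) ≢ n ℕ.+ n
1+[m+m]≢n+n m n eq with trans (sym (1+[m+m]%2≡1 m)) (trans (cong (_% 2) eq) ([m+m]%2≡0 n))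
... | ()

1+n%2≡1⇒n≡h+h : ∀ n → suc n % 2 ≡ 1 → ∃ λ h → n ≡ h ℕ.+ h
1+n%2≡1⇒n≡h+h n odd = q , ℕ.suc-injective (begin
  suc n                ≡⟨ m≡m%n+[m/n]*n (suc n) 2 ⟩
  suc n % 2 ℕ.+ q ℕ.* 2 ≡⟨ cong (ℕ._+ q ℕ.* 2) odd ⟩
  suc (q ℕ.* 2)        ≡⟨ cong suc (ℕ.*-comm q 2) ⟩
  suc (q ℕ.+ (q ℕ.+ 0)) ≡⟨ cong (λ r → suc (q ℕ.+ r)) (ℕ.+-identityʳ q) ⟩
  suc (q ℕ.+ q)        ∎)
  where
  open ≡-Reasoning
  q = suc n / 2

m+n≡o+o∧m<o⇒o<n : ∀ {m n o} → m ℕ.+ n ≡ o ℕ.+ o → m ℕ.< o → o ℕ.< n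
m+n≡o+o∧m<o⇒o<n m+n≡o+o m<o = ℕ.≰⇒> (λ n≤o → ℕ.<-irrefl m+n≡o+o (ℕ.+-mono-<-≤ m<o n≤o))

m+n≡o+o∧o<m⇒n<o : ∀ {m n o} → m ℕ.+ n ≡ o ℕ.+ o → o ℕ.< m → n ℕ.< o
m+n≡o+o∧o<m⇒n<o m+n≡o+o o<m = ℕ.≰⇒> (λ o≤n → ℕ.<-irrefl (sym m+n≡o+o) (ℕ.+-mono-<-≤ o<m o≤n))

m+m≡n+n⇒m≡n : ∀ {m n} → m ℕ.+ m ≡ n ℕ.+ n → m ≡ n
m+m≡n+n⇒m≡n {m} {n} m+m≡n+n with ℕ.<-cmp m n
... | tri< m<n _ _ = contradiction (m+n≡o+o∧m<o⇒o<n m+m≡n+n m<n) (ℕ.<-asym m<n)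
... | tri≈ _ m≡n _ = m≡n
... | tri> _ _ n<m = contradiction (m+n≡o+o∧o<m⇒n<o m+m≡n+n n<m) (ℕ.<-asym n<m)

-- Reversing indices

toℕ+toℕ-opposite : ∀ {n} (i : Fin n) → suc (toℕ i ℕ.+ toℕ (opposite i)) ≡ n
toℕ+toℕ-opposite {n} i = trans (cong (λ r → suc (toℕ i ℕ.+ r)) (opposite-prop i)) (ℕ.m+[n∸m]≡n (toℕ<n i))

suc-opposite : ∀ {n} (i : Fin n) → Fin.suc (opposite i) ≡ opposite (inject₁ i)
suc-opposite Fin.zero    = refl
suc-opposite (Fin.suc i) = cong inject₁ (suc-opposite i)

<opposite⇒<half : ∀ {n} (i : Fin n) → toℕ i ℕ.< toℕ (opposite i) → toℕ i ℕ.< n / 2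
<opposite⇒<half {n} i i<opp = begin
  suc (toℕ i)                       ≡⟨ m*n/n≡m (suc (toℕ i)) 2 ⟨
  suc (toℕ i) ℕ.* 2 / 2             ≤⟨ /-monoˡ-≤ 2 2[1+i]≤n ⟩
  n / 2                             ∎
  where
  open ℕ.≤-Reasoning
  [1+m]*2≡1+[m+1+m] : ∀ m → suc m ℕ.* 2 ≡ suc (m ℕ.+ suc m)
  [1+m]*2≡1+[m+1+m] = ℕ-Solver.solve-∀
  2[1+i]≤n : suc (toℕ i) ℕ.* 2 ℕ.≤ n
  2[1+i]≤n = begin
    suc (toℕ i) ℕ.* 2                 ≡⟨ [1+m]*2≡1+[m+1+m] (toℕ i) ⟩
    suc (toℕ i ℕ.+ suc (toℕ i))       ≤⟨ ℕ.s≤s (ℕ.+-monoʳ-≤ (toℕ i) i<opp) ⟩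
    suc (toℕ i ℕ.+ toℕ (opposite i))  ≡⟨ toℕ+toℕ-opposite i ⟩
    n                                 ∎

self-opposite⇒odd : ∀ {n} (i : Fin n) → opposite i ≡ i → suc (toℕ i ℕ.+ toℕ i) ≡ n
self-opposite⇒odd i opp≡i = trans (cong (λ k → suc (toℕ i ℕ.+ toℕ k)) (sym opp≡i)) (toℕ+toℕ-opposite i)

middle-self-opposite : ∀ {M h} → M ≡ h ℕ.+ h → (j : Fin (suc M)) → toℕ j ≡ h → opposite j ≡ j
middle-self-opposite {M} {h} M≡h+h j j≡h = toℕ-injective (trans (ℕ.+-cancelˡ-≡ h _ _ h+opp≡h+h) (sym j≡h))
  where
  h+opp≡h+h : h ℕ.+ toℕ (opposite j) ≡ h ℕ.+ h
  h+opp≡h+h = trans (cong (λ i → i ℕ.+ toℕ (opposite j)) (sym j≡h)) (trans (ℕ.suc-injective (toℕ+toℕ-opposite j)) M≡h+h)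

-- Strictly decreasing antisymmetric sequences

StrictlyDecreasing : (n : ℕ) → (Fin n → ℤ) → Set
StrictlyDecreasing n f = ∀ (i j : Fin n) → toℕ i ℕ.< toℕ j → f j ℤ.< f i

Antisymmetric : (n : ℕ) → (Fin n → ℤ) → Set
Antisymmetric n f = ∀ (i : Fin n) → f i + f (opposite i) ≡ + 0

adjacent⇒X⁺ : ∀ n (f : Fin (suc n) → ℤ) → (∀ (i : Fin n) → f (Fin.suc i) ℤ.≤ f (inject₁ i)) → X⁺ (suc n) f
adjacent⇒X⁺ n       f step Fin.zero    Fin.zero    _ = ℤ.≤-refl
adjacent⇒X⁺ (suc n) f step Fin.zero    (Fin.suc j) _ =
  ℤ.≤-trans (adjacent⇒X⁺ n (f ∘ Fin.suc) (step ∘ Fin.suc) Fin.zero j ℕ.z≤n) (step Fin.zero)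
adjacent⇒X⁺ (suc n) f step (Fin.suc i) (Fin.suc j) (ℕ.s≤s i≤j) =
  adjacent⇒X⁺ n (f ∘ Fin.suc) (step ∘ Fin.suc) i j i≤j

antisymmetric⇒opposite : ∀ {n} {f : Fin n → ℤ} → Antisymmetric n f → ∀ i → f (opposite i) ≡ - f i
antisymmetric⇒opposite {f = f} anti i = begin
  f (opposite i)              ≡⟨ y≡-x+[x+y] (f i) (f (opposite i)) ⟩
  - f i + (f i + f (opposite i)) ≡⟨ cong (λ s → - f i + s) (anti i) ⟩
  - f i + + 0                 ≡⟨ ℤ.+-identityʳ (- f i) ⟩
  - f i                       ∎
  where
  open ≡-Reasoning
  y≡-x+[x+y] : ∀ x y → y ≡ - x + (x + y)
  y≡-x+[x+y] = solve-∀

module _ {n : ℕ} {f : Fin n → ℤ} (f↓ : StrictlyDecreasing n f) where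

  strictlyDecreasing⇒X⁺ : X⁺ n f
  strictlyDecreasing⇒X⁺ i j i≤j with ℕ.m≤n⇒m<n∨m≡n i≤j
  ... | inj₁ i<j = ℤ.<⇒≤ (f↓ i j i<j)
  ... | inj₂ i≡j = ℤ.≤-reflexive (cong f (sym (toℕ-injective i≡j)))

  strictlyDecreasing-reflect-< : ∀ i j → f j ℤ.< f i → toℕ i ℕ.< toℕ j
  strictlyDecreasing-reflect-< i j fj<fi with toℕ j ℕ.≤? toℕ i
  ... | yes j≤i = contradiction (strictlyDecreasing⇒X⁺ j i j≤i) (ℤ.<⇒≱ fj<fi)
  ... | no  j≰i = ℕ.≰⇒> j≰i

  strictlyDecreasing-injective : ∀ {i j} → f i ≡ f j → i ≡ j
  strictlyDecreasing-injective {i} {j} fi≡fj with ℕ.<-cmp (toℕ i) (toℕ j)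
  ... | tri< i<j _ _ = contradiction (sym fi≡fj) (ℤ.<⇒≢ (f↓ i j i<j))
  ... | tri≈ _ i≡j _ = toℕ-injective i≡j
  ... | tri> _ _ j<i = contradiction fi≡fj (ℤ.<⇒≢ (f↓ j i j<i))

  module _ (anti : Antisymmetric n f) where

    positive⇒<half : ∀ k → + 0 ℤ.< f k → toℕ k ℕ.< n / 2
    positive⇒<half k 0<fk = <opposite⇒<half k (strictlyDecreasing-reflect-< k (opposite k) fopp<fk)
      where
      fopp<fk : f (opposite k) ℤ.< f k
      fopp<fk = subst (ℤ._< f k) (sym (antisymmetric⇒opposite {f = f} anti k)) (ℤ.<-trans (ℤ.neg-mono-< 0<fk) 0<fk)

    zero⇒self-opposite : ∀ k → f k ≡ + 0 → opposite k ≡ k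
    zero⇒self-opposite k fk≡0 = strictlyDecreasing-injective (begin
      f (opposite k) ≡⟨ antisymmetric⇒opposite {f = f} anti k ⟩
      - f k          ≡⟨ cong -_ fk≡0 ⟩
      + 0            ≡⟨ fk≡0 ⟨
      f k            ∎)
      where open ≡-Reasoning

InGap : ∀ {n} → (Fin (suc n) → ℤ) → ℤ → Fin n → Set
InGap l x p = x ℤ.< l (inject₁ p) × l (Fin.suc p) ℤ.≤ x

module _ {n : ℕ} {l : Fin (suc n) → ℤ} (l↓ : StrictlyDecreasing (suc n) l) where

  inGap-unique : ∀ {x p q} → InGap l x p → InGap l x q → p ≡ q
  inGap-unique {x} gp gq =
    toℕ-injective (ℕ.≤-antisym (ℕ.≮⇒≥ (not-before gq gp)) (ℕ.≮⇒≥ (not-before gp gq)))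
    where
    not-before : ∀ {p q} → InGap l x p → InGap l x q → ¬ (toℕ p ℕ.< toℕ q)
    not-before {p} {q} (_ , l[p+1]≤x) (x<l[q] , _) p<q =
      ℤ.<-irrefl refl (ℤ.<-≤-trans x<l[q] (ℤ.≤-trans l[q]≤l[p+1] l[p+1]≤x))
      where
      l[q]≤l[p+1] : l (inject₁ q) ℤ.≤ l (Fin.suc p)
      l[q]≤l[p+1] = strictlyDecreasing⇒X⁺ l↓ (Fin.suc p) (inject₁ q)
                      (subst (suc (toℕ p) ℕ.≤_) (sym (toℕ-inject₁ q)) p<q)

  inGap-opposite : Antisymmetric (suc n) l → ∀ {x p} → InGap l x p → l (Fin.suc p) ≢ x →
                   InGap l (- x) (opposite p)
  inGap-opposite anti {x} {p} (x<l[p] , l[p+1]≤x) l[p+1]≢x = -x<l[opp] , l[opp+1]≤-x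
    where
    l-opposite = antisymmetric⇒opposite {f = l} anti
    -x<l[opp] : - x ℤ.< l (inject₁ (opposite p))
    -x<l[opp] = subst (- x ℤ.<_) (sym (l-opposite (Fin.suc p))) (ℤ.neg-mono-< (ℤ.≤∧≢⇒< l[p+1]≤x l[p+1]≢x))
    l[opp+1]≤-x : l (Fin.suc (opposite p)) ℤ.≤ - x
    l[opp+1]≤-x = ℤ.<⇒≤ (subst (ℤ._< - x) (sym (trans (cong l (suc-opposite p)) (l-opposite (inject₁ p))))
                     (ℤ.neg-mono-< x<l[p]))

  module _ (l-even : ∀ i j → + 2 ∣ l i - l j) where

    shifted-X⁺ : X⁺ (suc n) (λ k → l k + + toℕ k * + 2)
    shifted-X⁺ = adjacent⇒X⁺ n _ step
      where
      y+[1+k]*2≡y+2+k*2 : ∀ y k → y + (+ 1 + k) * + 2 ≡ y + + 2 + k * + 2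
      y+[1+k]*2≡y+2+k*2 = solve-∀
      step : ∀ i → l (Fin.suc i) + + suc (toℕ i) * + 2 ℤ.≤ l (inject₁ i) + + toℕ (inject₁ i) * + 2
      step i = begin
        l (Fin.suc i) + + suc (toℕ i) * + 2     ≡⟨ y+[1+k]*2≡y+2+k*2 (l (Fin.suc i)) (+ toℕ i) ⟩
        l (Fin.suc i) + + 2 + + toℕ i * + 2     ≤⟨ ℤ.+-monoˡ-≤ (+ toℕ i * + 2) gap ⟩
        l (inject₁ i) + + toℕ i * + 2           ≡⟨ cong (λ k → l (inject₁ i) + + k * + 2) (toℕ-inject₁ i) ⟨
        l (inject₁ i) + + toℕ (inject₁ i) * + 2 ∎
        where
        open ℤ.≤-Reasoning
        gap : l (Fin.suc i) + + 2 ℤ.≤ l (inject₁ i)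
        gap = even-<⇒+2≤ (l-even (inject₁ i) (Fin.suc i))
                (l↓ (inject₁ i) (Fin.suc i) (subst (ℕ._< suc (toℕ i)) (sym (toℕ-inject₁ i)) (ℕ.n<1+n _)))

-- Poles of the sign characters in τ

sgn-pole-at : ∀ S D u b k → S + D ≡ - (+ u * + 2) → u ≡ b ℕ.+ k ℕ.* 2 → S + D + + (2 ℕ.* b) ≡ - + (4 ℕ.* k)
sgn-pole-at S D u b k S+D≡-2u u≡b+2k = begin
  S + D + + (2 ℕ.* b)                       ≡⟨ cong (λ s → s + + (2 ℕ.* b)) S+D≡-2u ⟩
  - (+ u * + 2) + + (2 ℕ.* b)               ≡⟨ cong (λ v → - (+ v * + 2) + + (2 ℕ.* b)) u≡b+2k ⟩
  - (+ (b ℕ.+ k ℕ.* 2) * + 2) + + (2 ℕ.* b) ≡⟨ cong₂ (λ x y → - (x * + 2) + y) (casts b k) (ℤ.pos-* 2 b) ⟩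
  - ((+ b + + k * + 2) * + 2) + + 2 * + b   ≡⟨ cancel (+ b) (+ k) ⟩
  - (+ 4 * + k)                             ≡⟨ cong -_ (ℤ.pos-* 4 k) ⟨
  - + (4 ℕ.* k)                             ∎
  where
  open ≡-Reasoning
  casts : ∀ b k → + (b ℕ.+ k ℕ.* 2) ≡ + b + + k * + 2
  casts b k = trans (ℤ.pos-+ b (k ℕ.* 2)) (cong (λ x → + b + x) (ℤ.pos-* k 2))
  cancel : ∀ b k → - ((b + k * + 2) * + 2) + + 2 * b ≡ - (+ 4 * k)
  cancel = solve-∀

sgn-pole : ∀ S D u → S + D ≡ - (+ u * + 2) → ∃ λ ε → IrrPole S (one ε D)
sgn-pole S D u S+D≡-2u with u divMod 2
... | result k Fin.zero             u≡2k   = false , k , sgn-pole-at S D u 0 k S+D≡-2u u≡2k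
... | result k (Fin.suc Fin.zero)   u≡1+2k = true  , k , sgn-pole-at S D u 1 k S+D≡-2u u≡1+2k

sgn-pair-pole : ∀ T D → + 2 ∣ T + D →
  (∃ λ ε → IrrPole T (one ε D)) ⊎ (∃ λ ε → IrrPole (+ 2 - T) (one ε (- D)))
sgn-pair-pole T D (divides (+ zero)   T+D≡0)     = inj₁ (sgn-pole T D 0 T+D≡0)
sgn-pair-pole T D (divides -[1+ u ]   T+D≡-2u-2) =
  inj₁ (sgn-pole T D (suc u) (trans T+D≡-2u-2 (sym (ℤ.neg-distribˡ-* (+ suc u) (+ 2)))))
sgn-pair-pole T D (divides (+ suc u)  T+D≡2u+2)  =
  inj₂ (sgn-pole (+ 2 - T) (- D) u (begin
    + 2 - T + - D          ≡⟨ reflect T D ⟩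
    + 2 - (T + D)          ≡⟨ cong (λ s → + 2 - s) T+D≡2u+2 ⟩
    + 2 - + suc u * + 2    ≡⟨ shift (+ u) ⟩
    - (+ u * + 2)          ∎))
  where
  reflect : ∀ T D → + 2 - T + - D ≡ + 2 - (T + D)
  reflect = solve-∀
  shift : ∀ u → + 2 - (+ 1 + u) * + 2 ≡ - (u * + 2)
  shift = solve-∀
  open ≡-Reasoning

two-∈-archRep : ∀ n w (l : Fin n → ℤ) δ k → toℕ k ℕ.< n / 2 → two ∣ l k ∣ (- w) ∈ archRep n w l δ
two-∈-archRep n w l δ k k<n/2 =
  ∈-++⁺ˡ (∈-map⁺ (λ i → two ∣ l i ∣ (- w)) (∈-filter⁺ (λ i → toℕ i ℕ.<? n / 2) (∈-allFin k) k<n/2))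

one-∈-tensorIrr : ∀ L D D' ε → one ε (D + D') ∈ tensorIrr (two L D) (two L D')
one-∈-tensorIrr L D D' ε rewrite Equivalence.to T-≡ (ℕ.≡⇒≡ᵇ L L refl) with ε
... | false = there (here refl)
... | true  = there (there (here refl))

∈-tensor : ∀ {ρ σ x y z} → x ∈ ρ → y ∈ σ → z ∈ tensorIrr x y → z ∈ tensor ρ σ
∈-tensor {σ = σ} {x} {z = z} x∈ρ y∈σ z∈xy =
  ∈-concatMap⁺ (λ r → concatMap (tensorIrr r) σ) (lose {P = λ r → z ∈ concatMap (tensorIrr r) σ} x∈ρ
    (∈-concatMap⁺ (tensorIrr x) (lose {P = λ s → z ∈ tensorIrr x s} y∈σ z∈xy)))

module _ {n m : ℕ} {w w' : ℤ} {l : Fin n → ℤ} {l' : Fin m → ℤ} {δ δ' : Bool}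
         (hl : L₀⁺ n w l) (hl' : L₀⁺ m w' l') {T : ℤ}
         (crit : Critical n m (τRep n m w l δ w' l' δ') T) where

  private
    D = - w + - w'

    sgn-∈-τ : ∀ k j → + 0 ℤ.< l k → l k ≡ l' j → ∀ ε → one ε D ∈ τRep n m w l δ w' l' δ'
    sgn-∈-τ k j 0<lk lk≡l'j ε = ∈-tensor (two-∈-archRep n w l δ k k<n/2) two∈σ (one-∈-tensorIrr ∣ l k ∣ (- w) (- w') ε)
      where
      k<n/2 = positive⇒<half (proj₁ hl) (proj₁ (proj₂ hl)) k 0<lk
      j<m/2 = positive⇒<half (proj₁ hl') (proj₁ (proj₂ hl')) j (subst (+ 0 ℤ.<_) lk≡l'j 0<lk)
      two∈σ : two ∣ l k ∣ (- w') ∈ archRep m w' l' δ'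
      two∈σ = subst (λ L → two L (- w') ∈ archRep m w' l' δ') (cong ∣_∣ (sym lk≡l'j)) (two-∈-archRep m w' l' δ' j j<m/2)

    2∣T+D : ∀ k j → l k ≡ l' j → + 2 ∣ T + D
    2∣T+D k j lk≡l'j = subst (+ 2 ∣_) (sym (regroup T w w' (l k) (+ n) (+ m)))
      (∣m∣n⇒∣m+n (∣m∣n⇒∣m-n (∣m∣n⇒∣m-n 2∣T-[n+m] 2∣w+lk-[1+n]) 2∣w'+lk-[1+m]) (divides (l k - + 1) refl))
      where
      2∣T-[n+m] : + 2 ∣ T - (+ n + + m)
      2∣T-[n+m] = ∣ᵤ⇒∣ (proj₁ crit)
      2∣w+lk-[1+n] : + 2 ∣ w + l k - (+ 1 + + n)
      2∣w+lk-[1+n] = ∣ᵤ⇒∣ (proj₂ (proj₂ hl) k)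
      2∣w'+lk-[1+m] : + 2 ∣ w' + l k - (+ 1 + + m)
      2∣w'+lk-[1+m] = subst (λ x → + 2 ∣ w' + x - (+ 1 + + m)) (sym lk≡l'j) (∣ᵤ⇒∣ (proj₂ (proj₂ hl') j))
      regroup : ∀ T w w' x N M → T + (- w + - w') ≡
                (T - (N + M)) - (w + x - (+ 1 + N)) - (w' + x - (+ 1 + M)) + (x - + 1) * + 2
      regroup = solve-∀

    no-shared-positive : ∀ k j → l k ≡ l' j → ¬ (+ 0 ℤ.< l k)
    no-shared-positive k j lk≡l'j 0<lk with sgn-pair-pole T D (2∣T+D k j lk≡l'j)
    ... | inj₁ (ε , pole) = proj₁ (proj₂ crit) (lose (sgn-∈-τ k j 0<lk lk≡l'j ε) pole)
    ... | inj₂ (ε , pole) = proj₂ (proj₂ crit) (lose (∈-map⁺ dualIrr (sgn-∈-τ k j 0<lk lk≡l'j ε)) pole)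

  shared-weight⇒zero : ∀ k j → l k ≡ l' j → l k ≡ + 0
  shared-weight⇒zero k j lk≡l'j with ℤ.<-cmp (l k) (+ 0)
  ... | tri≈ _ lk≡0 _ = lk≡0
  ... | tri> _ _ 0<lk = contradiction 0<lk (no-shared-positive k j lk≡l'j)
  ... | tri< lk<0 _ _ = contradiction 0<l[opp] (no-shared-positive (opposite k) (opposite j) l[opp]≡l'[opp])
    where
    l-opp = antisymmetric⇒opposite {f = l} (proj₁ (proj₂ hl))
    l'-opp = antisymmetric⇒opposite {f = l'} (proj₁ (proj₂ hl'))
    0<l[opp] : + 0 ℤ.< l (opposite k)
    0<l[opp] = subst (+ 0 ℤ.<_) (sym (l-opp k)) (ℤ.neg-mono-< lk<0)
    l[opp]≡l'[opp] : l (opposite k) ≡ l' (opposite j)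
    l[opp]≡l'[opp] = trans (l-opp k) (trans (cong -_ lk≡l'j) (sym (l'-opp j)))

-- λ_mod and λ_tr

module _ (M : ℕ) (x : Fin M → ℤ) where

  lamMod-< : ∀ j → toℕ j ℕ.< (M ℕ.+ 1) / 2 → lamMod M x j ≡ x j
  lamMod-< j j<c with toℕ j ℕ.<ᵇ (M ℕ.+ 1) / 2 | ℕ.<⇒<ᵇ j<c
  ... | true | _ = refl

  lamMod-≮ : ∀ j → ¬ toℕ j ℕ.< (M ℕ.+ 1) / 2 → lamMod M x j ≡ x j - + 1
  lamMod-≮ j j≮c with toℕ j ℕ.<ᵇ (M ℕ.+ 1) / 2 in eq
  ... | false = refl
  ... | true  = contradiction (ℕ.<ᵇ⇒< _ _ (subst T (sym eq) _)) j≮c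

  lamMod-X⁺ : X⁺ M x → X⁺ M (lamMod M x)
  lamMod-X⁺ x↓ i j i≤j with toℕ i ℕ.<? (M ℕ.+ 1) / 2 | toℕ j ℕ.<? (M ℕ.+ 1) / 2
  ... | yes i<c | yes j<c rewrite lamMod-< i i<c | lamMod-< j j<c = x↓ i j i≤j
  ... | yes i<c | no  j≮c rewrite lamMod-< i i<c | lamMod-≮ j j≮c = ℤ.i≤j⇒i-k≤j (+ 1) (x↓ i j i≤j)
  ... | no  i≮c | no  j≮c rewrite lamMod-≮ i i≮c | lamMod-≮ j j≮c = ℤ.+-monoˡ-≤ (- + 1) (x↓ i j i≤j)
  ... | no  i≮c | yes j<c = contradiction (ℕ.≤-<-trans i≤j j<c) i≮c

module _ (M : ℕ) (x : Fin (suc M) → ℤ) where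

  lamTr-< : ∀ k → toℕ k ℕ.< M / 2 → lamTr M x k ≡ x (inject₁ k)
  lamTr-< k k<c with toℕ k ℕ.<ᵇ M / 2 | ℕ.<⇒<ᵇ k<c
  ... | true | _ = refl

  lamTr-≮ : ∀ k → ¬ toℕ k ℕ.< M / 2 → lamTr M x k ≡ x (Fin.suc k)
  lamTr-≮ k k≮c with toℕ k ℕ.<ᵇ M / 2 in eq
  ... | false = refl
  ... | true  = contradiction (ℕ.<ᵇ⇒< _ _ (subst T (sym eq) _)) k≮c

  lamTr-X⁺ : X⁺ (suc M) x → X⁺ M (lamTr M x)
  lamTr-X⁺ x↓ i j i≤j with toℕ i ℕ.<? M / 2 | toℕ j ℕ.<? M / 2
  ... | yes i<c | yes j<c rewrite lamTr-< i i<c | lamTr-< j j<c =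
    x↓ (inject₁ i) (inject₁ j) (subst₂ ℕ._≤_ (sym (toℕ-inject₁ i)) (sym (toℕ-inject₁ j)) i≤j)
  ... | yes i<c | no  j≮c rewrite lamTr-< i i<c | lamTr-≮ j j≮c =
    x↓ (inject₁ i) (Fin.suc j) (subst (ℕ._≤ suc (toℕ j)) (sym (toℕ-inject₁ i)) (ℕ.m≤n⇒m≤1+n i≤j))
  ... | no  i≮c | no  j≮c rewrite lamTr-≮ i i≮c | lamTr-≮ j j≮c = x↓ (Fin.suc i) (Fin.suc j) (ℕ.s≤s i≤j)
  ... | no  i≮c | yes j<c = contradiction (ℕ.≤-<-trans i≤j j<c) i≮c

module _ (M h : ℕ) (M≡h+h : M ≡ h ℕ.+ h) (x : Fin (suc M) → ℤ) (K : ℤ)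
         (paired  : ∀ j → toℕ j ≢ h → x j + x (opposite j) + + 1 ≡ K)
         (central : ∀ j → toℕ j ≡ h → x j + x j + + 2 ≡ K) where

  private
    j+opp≡h+h : ∀ j → toℕ j ℕ.+ toℕ (opposite j) ≡ h ℕ.+ h
    j+opp≡h+h j = trans (ℕ.suc-injective (toℕ+toℕ-opposite j)) M≡h+h

    k+1+opp≡h+h : ∀ k → suc (toℕ k ℕ.+ toℕ (opposite k)) ≡ h ℕ.+ h
    k+1+opp≡h+h k = trans (toℕ+toℕ-opposite k) M≡h+h

    [1+M+1]/2≡1+h : (suc M ℕ.+ 1) / 2 ≡ suc h
    [1+M+1]/2≡1+h = trans (cong (λ m → (suc m ℕ.+ 1) / 2) M≡h+h) (trans (cong (_/ 2) (1+h+h+1≡[1+h]*2 h)) (m*n/n≡m (suc h) 2))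
      where
      1+h+h+1≡[1+h]*2 : ∀ h → suc (h ℕ.+ h) ℕ.+ 1 ≡ suc h ℕ.* 2
      1+h+h+1≡[1+h]*2 = ℕ-Solver.solve-∀

    M/2≡h : M / 2 ≡ h
    M/2≡h = trans (cong (_/ 2) (trans M≡h+h (h+h≡h*2 h))) (m*n/n≡m h 2)
      where
      h+h≡h*2 : ∀ h → h ℕ.+ h ≡ h ℕ.* 2
      h+h≡h*2 = ℕ-Solver.solve-∀

    regroupˡ : ∀ a b → a + (b - + 1) ≡ a + b + + 1 - + 2
    regroupˡ = solve-∀
    regroupʳ : ∀ a b → (a - + 1) + b ≡ a + b + + 1 - + 2
    regroupʳ = solve-∀

  lamMod-pairs : ∀ j → lamMod _ x j + lamMod _ x (opposite j) ≡ K - + 2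
  lamMod-pairs j with ℕ.<-cmp (toℕ j) h
  ... | tri< j<h _ _ = begin
    lamMod _ x j + lamMod _ x (opposite j) ≡⟨ cong₂ _+_ (lamMod-< _ x j j<c) (lamMod-≮ _ x (opposite j) opp≮c) ⟩
    x j + (x (opposite j) - + 1)          ≡⟨ regroupˡ (x j) (x (opposite j)) ⟩
    x j + x (opposite j) + + 1 - + 2      ≡⟨ cong (λ s → s - + 2) (paired j (ℕ.<⇒≢ j<h)) ⟩
    K - + 2                               ∎
    where
    open ≡-Reasoning
    j<c = subst (toℕ j ℕ.<_) (sym [1+M+1]/2≡1+h) (ℕ.m<n⇒m<1+n j<h)
    opp≮c : ¬ toℕ (opposite j) ℕ.< (suc M ℕ.+ 1) / 2
    opp≮c opp<c = ℕ.<⇒≱ (m+n≡o+o∧m<o⇒o<n (j+opp≡h+h j) j<h) (ℕ.s≤s⁻¹ (subst (toℕ (opposite j) ℕ.<_) [1+M+1]/2≡1+h opp<c))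
  ... | tri≈ _ j≡h _ = begin
    lamMod _ x j + lamMod _ x (opposite j) ≡⟨ cong (λ i → lamMod _ x j + lamMod _ x i) opp≡j ⟩
    lamMod _ x j + lamMod _ x j            ≡⟨ cong (λ y → y + y) (lamMod-< _ x j j<c) ⟩
    x j + x j                             ≡⟨ i+k≡j⇒i≡j-k (+ 2) (central j j≡h) ⟩
    K - + 2                               ∎
    where
    open ≡-Reasoning
    j<c = subst (toℕ j ℕ.<_) (sym [1+M+1]/2≡1+h) (ℕ.s≤s (ℕ.≤-reflexive j≡h))
    opp≡j = middle-self-opposite M≡h+h j j≡h
  ... | tri> _ _ h<j = begin
    lamMod _ x j + lamMod _ x (opposite j) ≡⟨ cong₂ _+_ (lamMod-≮ _ x j j≮c) (lamMod-< _ x (opposite j) opp<c) ⟩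
    (x j - + 1) + x (opposite j)          ≡⟨ regroupʳ (x j) (x (opposite j)) ⟩
    x j + x (opposite j) + + 1 - + 2      ≡⟨ cong (λ s → s - + 2) (paired j (ℕ.>⇒≢ h<j)) ⟩
    K - + 2                               ∎
    where
    open ≡-Reasoning
    j≮c : ¬ toℕ j ℕ.< (suc M ℕ.+ 1) / 2
    j≮c j<c = ℕ.<⇒≱ h<j (ℕ.s≤s⁻¹ (subst (toℕ j ℕ.<_) [1+M+1]/2≡1+h j<c))
    opp<c = subst (toℕ (opposite j) ℕ.<_) (sym [1+M+1]/2≡1+h) (ℕ.m<n⇒m<1+n (m+n≡o+o∧o<m⇒n<o (j+opp≡h+h j) h<j))

  lamTr-pairs : ∀ k → lamTr M x k + lamTr M x (opposite k) ≡ K - + 1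
  lamTr-pairs k with toℕ k ℕ.<? h
  ... | yes k<h = begin
    lamTr _ x k + lamTr _ x (opposite k)             ≡⟨ cong₂ _+_ (lamTr-< _ x k (subst (toℕ k ℕ.<_) (sym M/2≡h) k<h))
                                                                  (lamTr-≮ _ x (opposite k) opp≮c) ⟩
    x (inject₁ k) + x (Fin.suc (opposite k))         ≡⟨ cong (λ i → x (inject₁ k) + x i) (suc-opposite k) ⟩
    x (inject₁ k) + x (opposite (inject₁ k))         ≡⟨ i+k≡j⇒i≡j-k (+ 1) (paired (inject₁ k) (ℕ.<⇒≢ (subst (ℕ._< h) (sym (toℕ-inject₁ k)) k<h))) ⟩
    K - + 1                                          ∎
    where
    open ≡-Reasoning
    opp≮c : ¬ toℕ (opposite k) ℕ.< M / 2
    opp≮c opp<c = ℕ.<⇒≱ (m+n≡o+o∧m<o⇒o<n (trans (ℕ.+-suc _ _) (k+1+opp≡h+h k)) k<h)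
                         (subst (toℕ (opposite k) ℕ.<_) M/2≡h opp<c)
  ... | no k≮h = begin
    lamTr _ x k + lamTr _ x (opposite k)             ≡⟨ cong₂ _+_ (lamTr-≮ _ x k (λ k<c → k≮h (subst (toℕ k ℕ.<_) M/2≡h k<c)))
                                                                  (lamTr-< _ x (opposite k) (subst (toℕ (opposite k) ℕ.<_) (sym M/2≡h) opp<h)) ⟩
    x (Fin.suc k) + x (opposite (Fin.suc k))         ≡⟨ i+k≡j⇒i≡j-k (+ 1) (paired (Fin.suc k) (ℕ.>⇒≢ (ℕ.s≤s (ℕ.≮⇒≥ k≮h)))) ⟩
    K - + 1                                          ∎
    where
    open ≡-Reasoning
    opp<h : toℕ (opposite k) ℕ.< h
    opp<h = m+n≡o+o∧o<m⇒n<o (k+1+opp≡h+h k) (ℕ.s≤s (ℕ.≮⇒≥ k≮h))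

-- The position tuple

module PositionTuple
  {n₀ m₀ : ℕ} {w w' : ℤ} {l : Fin (suc n₀) → ℤ} {l' : Fin (suc m₀) → ℤ}
  (hl : L₀⁺ (suc n₀) w l) (hl' : L₀⁺ (suc m₀) w' l')
  (shared⇒zero : ∀ k j → l k ≡ l' j → l k ≡ + 0)
  (a : Fin (suc m₀) → Fin n₀) (pos : IsPositionTuple n₀ (suc m₀) l l' a) where

  private
    l↓ = proj₁ hl
    l'↓ = proj₁ hl'
    l-anti = proj₁ (proj₂ hl)
    l'-anti = proj₁ (proj₂ hl')

    l-parity : ∀ i → + 2 ∣ w + l i - + suc (suc n₀)
    l-parity i = ∣ᵤ⇒∣ (proj₂ (proj₂ hl) i)

    l'-parity : ∀ j → + 2 ∣ w' + l' j - + suc (suc m₀)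
    l'-parity j = ∣ᵤ⇒∣ (proj₂ (proj₂ hl') j)

    A : Fin (suc m₀) → ℕ
    A j = toℕ (a j)

  Λ : Fin (suc m₀) → ℤ
  Λ = lam n₀ (suc m₀) w' l' a

  C : ℤ
  C = w' + + 1 - + suc m₀

  B : Fin (suc m₀) → ℤ
  B j = l' j + + A j * + 2

  ν*2 : ∀ j → ν (suc m₀) w' l' j * + 2 ≡ w' + l' j + (+ 2 * + toℕ j + + 1) - + suc m₀
  ν*2 j = trans (i/ℕd*d≡i _ 2 (∣⇒∣ᵤ 2∣e)) cast
    where
    t = toℕ j
    cast : w' + l' j + + (2 ℕ.* t ℕ.+ 1) - + suc m₀ ≡ w' + l' j + (+ 2 * + t + + 1) - + suc m₀
    cast = cong (λ u → w' + l' j + (u + + 1) - + suc m₀) (ℤ.pos-* 2 t)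
    split : ∀ w x J M → w + x + (+ 2 * J + + 1) - M ≡ (w + x - (+ 1 + M)) + (J + + 1) * + 2
    split = solve-∀
    2∣e : + 2 ∣ w' + l' j + + (2 ℕ.* t ℕ.+ 1) - + suc m₀
    2∣e = subst (+ 2 ∣_) (sym (trans cast (split w' (l' j) (+ t) (+ suc m₀))))
            (∣m∣n⇒∣m+n (l'-parity j) (divides (+ t + + 1) refl))

  Λ*2≡C+B : ∀ j → Λ j * + 2 ≡ C + B j
  Λ*2≡C+B j = begin
    Λ j * + 2                                                        ≡⟨ distrib (ν (suc m₀) w' l' j) (+ A j) (+ toℕ j) ⟩
    ν (suc m₀) w' l' j * + 2 + + A j * + 2 - + toℕ j * + 2             ≡⟨ cong (λ v → v + + A j * + 2 - + toℕ j * + 2) (ν*2 j) ⟩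
    w' + l' j + (+ 2 * + toℕ j + + 1) - + suc m₀ + + A j * + 2 - + toℕ j * + 2 ≡⟨ collect w' (l' j) (+ toℕ j) (+ suc m₀) (+ A j) ⟩
    C + B j                                                          ∎
    where
    open ≡-Reasoning
    distrib : ∀ v a J → (v + a - J) * + 2 ≡ v * + 2 + a * + 2 - J * + 2
    distrib = solve-∀
    collect : ∀ w x J M a → w + x + (+ 2 * J + + 1) - M + a * + 2 - J * + 2 ≡ w + + 1 - M + (x + a * + 2)
    collect = solve-∀

  B-X⁺ : X⁺ (suc m₀) B
  B-X⁺ i j i≤j with A j ℕ.≤? A i
  ... | yes Aj≤Ai = ℤ.+-mono-≤ (strictlyDecreasing⇒X⁺ l'↓ i j i≤j) (ℤ.*-monoʳ-≤-nonNeg (+ 2) (+≤+ Aj≤Ai))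
  ... | no  Aj≰Ai = even-gap 2∣Bi-Bj (begin-strict
    B j                                       <⟨ ℤ.+-monoˡ-< (+ A j * + 2) (proj₁ (pos j)) ⟩
    l (inject₁ (a j)) + + A j * + 2           ≡⟨ cong (λ k → l (inject₁ (a j)) + + k * + 2) (toℕ-inject₁ (a j)) ⟨
    l (inject₁ (a j)) + + toℕ (inject₁ (a j)) * + 2
                                              ≤⟨ shifted-X⁺ l↓ (even-diff w _ l l-parity) (Fin.suc (a i)) (inject₁ (a j)) 1+Ai≤Aj ⟩
    l (Fin.suc (a i)) + + suc (A i) * + 2     ≤⟨ ℤ.+-monoˡ-≤ (+ suc (A i) * + 2) (proj₂ (pos i)) ⟩
    l' i + + suc (A i) * + 2                  ≡⟨ shift (l' i) (+ A i) ⟩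
    B i + + 2                                 ∎)
    where
    open ℤ.≤-Reasoning
    1+Ai≤Aj : suc (A i) ℕ.≤ toℕ (inject₁ (a j))
    1+Ai≤Aj = subst (suc (A i) ℕ.≤_) (sym (toℕ-inject₁ (a j))) (ℕ.≰⇒> Aj≰Ai)
    shift : ∀ x k → x + (+ 1 + k) * + 2 ≡ x + k * + 2 + + 2
    shift = solve-∀
    regroup : ∀ x y a b → (x + a * + 2) - (y + b * + 2) ≡ (x - y) + (a - b) * + 2
    regroup = solve-∀
    2∣Bi-Bj : + 2 ∣ B i - B j
    2∣Bi-Bj = subst (+ 2 ∣_) (sym (regroup (l' i) (l' j) (+ A i) (+ A j)))
                (∣m∣n⇒∣m+n (even-diff w' _ l' l'-parity i j) (divides (+ A i - + A j) refl))

  Λ-X⁺ : X⁺ (suc m₀) Λ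
  Λ-X⁺ i j i≤j = ℤ.*-cancelʳ-≤-pos (Λ j) (Λ i) (+ 2)
    (subst₂ ℤ._≤_ (sym (Λ*2≡C+B j)) (sym (Λ*2≡C+B i)) (ℤ.+-monoʳ-≤ C (B-X⁺ i j i≤j)))

  K : ℤ
  K = C + + n₀

  Λ-pair : ∀ i j s → l' i + l' j ≡ + 0 → s ℕ.+ (A i ℕ.+ A j) ≡ n₀ → Λ i + Λ j + + s ≡ K
  Λ-pair i j s l'i+l'j≡0 s+Ai+Aj≡n₀ = ℤ.*-cancelʳ-≡ _ _ (+ 2) (begin
    (Λ i + Λ j + + s) * + 2                               ≡⟨ distrib (Λ i) (Λ j) (+ s) ⟩
    Λ i * + 2 + Λ j * + 2 + + s * + 2                     ≡⟨ cong₂ (λ x y → x + y + + s * + 2) (Λ*2≡C+B i) (Λ*2≡C+B j) ⟩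
    (C + B i) + (C + B j) + + s * + 2                     ≡⟨ regroup C (l' i) (l' j) (+ A i) (+ A j) (+ s) ⟩
    C + C + (l' i + l' j) + + (s ℕ.+ (A i ℕ.+ A j)) * + 2 ≡⟨ cong₂ (λ x y → C + C + x + + y * + 2) l'i+l'j≡0 s+Ai+Aj≡n₀ ⟩
    C + C + + 0 + + n₀ * + 2                              ≡⟨ collect C (+ n₀) ⟩
    K * + 2                                               ∎)
    where
    open ≡-Reasoning
    distrib : ∀ x y s → (x + y + s) * + 2 ≡ x * + 2 + y * + 2 + s * + 2
    distrib = solve-∀
    regroup : ∀ C x y a b s → (C + (x + a * + 2)) + (C + (y + b * + 2)) + s * + 2 ≡ C + C + (x + y) + (s + (a + b)) * + 2
    regroup = solve-∀
    collect : ∀ C n → C + C + + 0 + n * + 2 ≡ (C + n) * + 2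
    collect = solve-∀

  -- l'_j is tight when it equals the lower end l_{a_j+1} of its gap, strict otherwise.
  strict⇒a-opposite : ∀ j → l (Fin.suc (a j)) ≢ l' j → a (opposite j) ≡ opposite (a j)
  strict⇒a-opposite j strict = inGap-unique l↓ (pos (opposite j))
    (subst (λ x → InGap l x (opposite (a j))) (sym (antisymmetric⇒opposite {f = l'} l'-anti j))
      (inGap-opposite l↓ l-anti (pos j) strict))

  strict⇒pair : ∀ j → l (Fin.suc (a j)) ≢ l' j → Λ j + Λ (opposite j) + + 1 ≡ K
  strict⇒pair j strict = Λ-pair j (opposite j) 1 (l'-anti j)
    (trans (cong (λ p → suc (A j ℕ.+ toℕ p)) (strict⇒a-opposite j strict)) (toℕ+toℕ-opposite (a j)))

  tight⇒zero : ∀ j → l (Fin.suc (a j)) ≡ l' j → l' j ≡ + 0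
  tight⇒zero j tight = trans (sym tight) (shared⇒zero (Fin.suc (a j)) j tight)

  tight⇒self-opposite : ∀ j → l (Fin.suc (a j)) ≡ l' j →
                        opposite j ≡ j × opposite (Fin.suc (a j)) ≡ Fin.suc (a j)
  tight⇒self-opposite j tight =
    zero⇒self-opposite l'↓ l'-anti j (tight⇒zero j tight) ,
    zero⇒self-opposite l↓ l-anti (Fin.suc (a j)) (trans tight (tight⇒zero j tight))

  tight⇒pair : ∀ j → l (Fin.suc (a j)) ≡ l' j → Λ j + Λ j + + 2 ≡ K
  tight⇒pair j tight = Λ-pair j j 2 l'j+l'j≡0
    (trans (cong suc (sym (ℕ.+-suc (A j) (A j))))
           (ℕ.suc-injective (self-opposite⇒odd (Fin.suc (a j)) (proj₂ (tight⇒self-opposite j tight)))))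
    where
    l'j+l'j≡0 : l' j + l' j ≡ + 0
    l'j+l'j≡0 = cong (λ x → x + x) (tight⇒zero j tight)

  tight⇒odd : ∀ j → l (Fin.suc (a j)) ≡ l' j → suc n₀ % 2 ≡ 1 × suc m₀ % 2 ≡ 1
  tight⇒odd j tight = odd (Fin.suc (a j)) (proj₂ self-opp) , odd j (proj₁ self-opp)
    where
    self-opp = tight⇒self-opposite j tight
    odd : ∀ {N} (i : Fin N) → opposite i ≡ i → N % 2 ≡ 1
    odd i opp≡i = subst (λ N → N % 2 ≡ 1) (self-opposite⇒odd i opp≡i) (1+[m+m]%2≡1 (toℕ i))

  module _ (n-odd : suc n₀ % 2 ≡ 1) (m-odd : suc m₀ % 2 ≡ 1) where

    private
      g = proj₁ (1+n%2≡1⇒n≡h+h n₀ n-odd)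
      n₀≡g+g = proj₂ (1+n%2≡1⇒n≡h+h n₀ n-odd)
      h = proj₁ (1+n%2≡1⇒n≡h+h m₀ m-odd)
      m₀≡h+h = proj₂ (1+n%2≡1⇒n≡h+h m₀ m-odd)

      middle⇒tight : ∀ j → toℕ j ≡ h → l (Fin.suc (a j)) ≡ l' j
      middle⇒tight j j≡h with l (Fin.suc (a j)) ℤ.≟ l' j
      ... | yes tight = tight
      ... | no  strict = contradiction (trans (self-opposite⇒odd (a j) opp[aj]≡aj) n₀≡g+g) (1+[m+m]≢n+n (A j) g)
        where
        opp[aj]≡aj : opposite (a j) ≡ a j
        opp[aj]≡aj = trans (sym (strict⇒a-opposite j strict)) (cong a (middle-self-opposite m₀≡h+h j j≡h))

      tight⇒middle : ∀ j → l (Fin.suc (a j)) ≡ l' j → toℕ j ≡ h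
      tight⇒middle j tight = m+m≡n+n⇒m≡n (ℕ.suc-injective
        (trans (self-opposite⇒odd j (proj₁ (tight⇒self-opposite j tight))) (cong suc m₀≡h+h)))

      paired : ∀ j → toℕ j ≢ h → Λ j + Λ (opposite j) + + 1 ≡ K
      paired j j≢h = strict⇒pair j (j≢h ∘ tight⇒middle j)

      central : ∀ j → toℕ j ≡ h → Λ j + Λ j + + 2 ≡ K
      central j j≡h = tight⇒pair j (middle⇒tight j j≡h)

    lamMod-Λ-X₀⁺ : X₀⁺ (suc m₀) (lamMod (suc m₀) Λ)
    lamMod-Λ-X₀⁺ = lamMod-X⁺ (suc m₀) Λ Λ-X⁺ , K - + 2 , lamMod-pairs m₀ h m₀≡h+h Λ K paired central

    lamTr-Λ-X₀⁺ : X₀⁺ m₀ (lamTr m₀ Λ)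
    lamTr-Λ-X₀⁺ = lamTr-X⁺ m₀ Λ Λ-X⁺ , K - + 1 , lamTr-pairs m₀ h m₀≡h+h Λ K paired central

X₀⁺-length-one : ∀ {M} (x : Fin (suc M) → ℤ) → suc M ≡ 1 → X₀⁺ (suc M) x
X₀⁺-length-one x refl = (λ { Fin.zero Fin.zero _ → ℤ.≤-refl }) , x Fin.zero + x Fin.zero , λ { Fin.zero → refl }

corollary3p1 : (n₀ m₀ : ℕ) (w : ℤ) (l : Fin (suc n₀) → ℤ) (δ : Bool)
    (w' : ℤ) (l' : Fin (suc m₀) → ℤ) (δ' : Bool) →
    L₀⁺ (suc n₀) w l →
    L₀⁺ (suc m₀) w' l' →
    CriticalNonempty (suc n₀) (suc m₀) (τRep (suc n₀) (suc m₀) w l δ w' l' δ') →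
    l' Fin.zero ℤ.< l Fin.zero →
    (a : Fin (suc m₀) → Fin n₀) →
    IsPositionTuple n₀ (suc m₀) l l' a →
    (¬ ((suc n₀ % 2 ≡ 1) × (suc m₀ % 2 ≡ 1)) →
       X₀⁺ (suc m₀) (lam n₀ (suc m₀) w' l' a))
    × ((suc n₀ % 2 ≡ 1) → (suc m₀ % 2 ≡ 1) → 1 ℕ.< suc m₀ →
       X₀⁺ (suc m₀) (lamMod (suc m₀) (lam n₀ (suc m₀) w' l' a))
       × X₀⁺ m₀ (lamTr m₀ (lam n₀ (suc m₀) w' l' a)))
    × (suc m₀ ≡ 1 → X₀⁺ (suc m₀) (lam n₀ (suc m₀) w' l' a))
corollary3p1 n₀ m₀ w l δ w' l' δ' hl hl' (T , crit) _ a pos =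
  not-both-odd , (λ n-odd m-odd _ → lamMod-Λ-X₀⁺ n-odd m-odd , lamTr-Λ-X₀⁺ n-odd m-odd) , X₀⁺-length-one Λ
  where
  open PositionTuple {w = w} {w' = w'} hl hl' (shared-weight⇒zero hl hl' crit) a pos
  not-both-odd : ¬ ((suc n₀ % 2 ≡ 1) × (suc m₀ % 2 ≡ 1)) → X₀⁺ (suc m₀) Λ
  not-both-odd not-odd = Λ-X⁺ , K - + 1 , λ j → i+k≡j⇒i≡j-k (+ 1) (strict⇒pair j (not-odd ∘ tight⇒odd j))
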